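{- Let $f_0=1,f_1=1,f_2=2,\dots$ be the Fibonacci numbers ($f_{t+1}=f_t+f_{t-1}$). For a positive integer $L$ let $p=f_L$ and $q=f_{L+1}$. There are absolute constants $c_1,c_2>0$ (independent of $L$) such that: for all integers $v\ne v'$ with $v,v'\in(-c_2q,c_2q)$, $$\rho_q(pv,pv')>\frac{c_1q}{\max\{|v|,|v'|\}};$$ and furthermore, for any $i\in\{1,\dots,q\}$ and any $t\le L$, there is a $v\in\{ -f_t,\dots,f_t\}$ such that $\rho_q(i,pv)\le\frac{3q}{f_t}$.
   Context: $\rho_q$ is the Lee metric on $\mathbb{Z}_q$: $\rho_q(a,b)$ is the minimum of $|j|$ over all integers $j$ with $a\equiv b+j\pmod q$. -}

module Defs where

open import Data.Nat using (ℕ; zero; suc; _≤_) renaming (_+_ to _ℕ+_)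
open import Data.Integer using (ℤ; +_; _+_; _-_; ∣_∣)
open import Data.Integer.Divisibility using (_∣_)
open import Data.Product using (Σ; _×_)
open import Relation.Binary.PropositionalEquality using (_≡_)

fib : ℕ → ℕ
fib zero = 1
fib (suc zero) = 1
fib (suc (suc n)) = fib (suc n) ℕ+ fib n

_≡_[mod_] : ℤ → ℤ → ℕ → Set
a ≡ b [mod q ] = (+ q) ∣ (a - b)

-- Lee metric, exactly as in the paper:
-- ρ_q(a,b) = min { |j| : j ∈ ℤ, a ≡ b + j (mod q) }.
-- IsLee q a b d  means  "ρ_q(a,b) = d".
IsLee : ℕ → ℤ → ℤ → ℕ → Set
IsLee q a b d =
  Σ ℤ (λ j → (a ≡ b + j [mod q ]) × (∣ j ∣ ≡ d))
  × (∀ (j : ℤ) → a ≡ b + j [mod q ] → d ≤ ∣ j ∣)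

module Submission where

-- Separation (c₁ = 1/7, c₂ = 1/4).  For v ≠ v′ in (-q/4, q/4) put w = v - v′;
-- then 1 ≤ |w| < p, so fib n ≤ |w| < fib (n + 1) with L = n + (m + 1).  Every
-- offset between pv′ and pv has the form pw - qk, and rewriting it in the
-- coordinates supplied by Cassini's identity and the addition formula shows
-- |pw - qk| ≥ fib (m + 1).  As q ≤ 3 fib (m + 1) fib n, this gives
-- q ≤ 3 ρ |w| ≤ 6 ρ max(|v|, |v′|) < 7 ρ max(|v|, |v′|).
--
-- Approximation.  For t = u + 1 ≤ L = t + k write q = γα + δβ with α, β, γ, δ
-- the Fibonacci numbers at u + 1, u, k + 1, k.  The floors x = ⌊iβ/q⌋,
-- y = ⌊iα/q⌋ give a multiplier v = ±(yβ - xα) with |v| ≤ α = fib t, and by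
-- d'Ocagne's identity pv ≡ xδ + yγ = i - e (mod q) with 0 ≤ e < 2γ, so that
-- ρ_q(i, pv) fib t ≤ 2q.  The case t = 0 is trivial with v = 0.

open import Defs

module LeeMetric where

  -- Terminology: an offset j realises the congruence a ≡ b + j (mod q), and
  -- ρ_q(a,b) is the least |j| over all such offsets.

  open import Data.Nat as ℕ using (ℕ; suc; _≤_; _<_; _∸_; NonZero)
  import Data.Nat.Properties as ℕₚ
  import Data.Nat.Divisibility as ℕᵈ
  open import Data.Integer using (ℤ; +_; -[1+_]; ∣_∣; _+_; _-_; -_; _*_)
  import Data.Integer.Properties as ℤₚ
  import Data.Integer.Divisibility.Signed as Signed
  open import Data.Integer.Divisibility using (_∣_)
  open import Data.Integer.DivMod using (_%ℕ_; _/ℕ_; n%ℕd<d; a≡a%ℕn+[a/ℕn]*n)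
  open import Data.Integer.Tactic.RingSolver using (solve-∀)
  open import Data.Product using (Σ; _,_)
  open import Data.Sum using (_⊎_; inj₁; inj₂; [_,_]′)
  open import Function using (id)
  open import Data.Empty using (⊥-elim)
  open import Relation.Nullary using (yes; no)
  open import Relation.Binary.PropositionalEquality using (_≡_; refl; sym; trans; cong; subst)

  congruence-quotient : ∀ {q} (a b : ℤ) {j : ℤ} → a ≡ b + j [mod q ] →
                        Σ ℤ λ t → a - (b + j) ≡ t * + q
  congruence-quotient a b h with Signed.∣ᵤ⇒∣ h
  ... | Signed.divides t eq = t , eq

  offset-difference : ∀ {q} (a b j j′ : ℤ) → a ≡ b + j [mod q ] → a ≡ b + j′ [mod q ] →
                      (+ q) ∣ (j′ - j)
  offset-difference {q} a b j j′ h h′ =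
    Signed.∣⇒∣ᵤ (subst (Signed._∣_ (+ q)) (difference a b j j′)
                       (Signed.∣m∣n⇒∣m-n (Signed.∣ᵤ⇒∣ {i = a - (b + j)} h) (Signed.∣ᵤ⇒∣ {i = a - (b + j′)} h′)))
    where
      difference : ∀ (a b j j′ : ℤ) → (a - (b + j)) - (a - (b + j′)) ≡ j′ - j
      difference = solve-∀

  -- Every j ≡ r (mod q), for a residue 0 ≤ r < q, has |j| ≥ r or |j| ≥ q - r:
  -- a non-negative j below r would give a positive multiple r - j of q below q,
  -- and a negative j gives the multiple r + |j| ≥ q.
  residue-distance : ∀ {q r} (j : ℤ) → r < q → (+ q) ∣ (+ r - j) →
                     r ≤ ∣ j ∣ ⊎ q ∸ r ≤ ∣ j ∣
  residue-distance {q} {r} (+ m) r<q q∣r-m with r ℕ.≤? m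
  ... | yes r≤m = inj₁ r≤m
  ... | no r≰m = ⊥-elim (ℕₚ.<⇒≱ r<q (ℕₚ.≤-trans q≤r∸m (ℕₚ.m∸n≤m r m)))
    where
      m<r = ℕₚ.≰⇒> r≰m
      ∣r-m∣≡r∸m : ∣ + r - + m ∣ ≡ r ∸ m
      ∣r-m∣≡r∸m = cong ∣_∣ (trans (ℤₚ.m-n≡m⊖n r m) (ℤₚ.⊖-≥ (ℕₚ.<⇒≤ m<r)))
      instance
        r∸m≢0 : NonZero (r ∸ m)
        r∸m≢0 = ℕ.>-nonZero (ℕₚ.m<n⇒0<n∸m m<r)
      q≤r∸m : q ≤ r ∸ m
      q≤r∸m = ℕᵈ.∣⇒≤ (subst (q ℕᵈ.∣_) ∣r-m∣≡r∸m q∣r-m)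
  residue-distance {q} {r} -[1+ m ] r<q q∣r+m = inj₂ (ℕₚ.m≤n+o⇒m∸n≤o q r (ℕᵈ.∣⇒≤ q∣r+m))
    where
      instance
        r+m+1≢0 : NonZero (r ℕ.+ suc m)
        r+m+1≢0 = ℕ.>-nonZero (ℕₚ.<-≤-trans ℕ.z<s (ℕₚ.m≤n+m (suc m) r))

  complementary-offset : ∀ {q r} (a b : ℤ) → r ≤ q → a ≡ b + + r [mod q ] →
                         a ≡ b + - + (q ∸ r) [mod q ]
  complementary-offset {q} {r} a b r≤q h =
    Signed.∣⇒∣ᵤ (subst (Signed._∣_ (+ q)) shift
                       (Signed.∣m∣n⇒∣m+n (Signed.∣ᵤ⇒∣ {i = a - (b + + r)} h) Signed.∣-refl))
    where
      q-r : + (q ∸ r) ≡ + q - + r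
      q-r = sym (trans (ℤₚ.m-n≡m⊖n q r) (ℤₚ.⊖-≥ r≤q))
      regroup : ∀ (a b q r : ℤ) → (a - (b + r)) + q ≡ a - (b + - (q - r))
      regroup = solve-∀
      shift : (a - (b + + r)) + + q ≡ a - (b + - + (q ∸ r))
      shift = trans (regroup a b (+ q) (+ r)) (cong (λ x → a - (b + - x)) (sym q-r))

  lee-from-residue : ∀ {q r} (a b : ℤ) → r < q → a ≡ b + + r [mod q ] → Σ ℕ (IsLee q a b)
  lee-from-residue {q} {r} a b r<q a≡b+r with ℕₚ.≤-total r (q ∸ r)
  ... | inj₁ r≤q∸r =
    r , (+ r , a≡b+r , refl) ,
    λ j h → [ id , ℕₚ.≤-trans r≤q∸r ]′ (residue-distance j r<q (offset-difference a b j (+ r) h a≡b+r))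
  ... | inj₂ q∸r≤r =
    q ∸ r , (- + (q ∸ r) , complementary-offset a b (ℕₚ.<⇒≤ r<q) a≡b+r , ℤₚ.∣-i∣≡∣i∣ (+ (q ∸ r))) ,
    λ j h → [ ℕₚ.≤-trans q∸r≤r , id ]′ (residue-distance j r<q (offset-difference a b j (+ r) h a≡b+r))

  lee-exists : ∀ q .{{_ : NonZero q}} (a b : ℤ) → Σ ℕ (IsLee q a b)
  lee-exists q a b = lee-from-residue a b (n%ℕd<d (a - b) q) a≡b+r
    where
      t = (a - b) /ℕ q
      r = (a - b) %ℕ q
      remove-remainder : ∀ (a b r tq : ℤ) → a - b ≡ r + tq → a - (b + r) ≡ tq
      remove-remainder a b r tq eq = trans (regroup a b r) (trans (cong (_- r) eq) (cancel r tq))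
        where
          regroup : ∀ (a b r : ℤ) → a - (b + r) ≡ (a - b) - r
          regroup = solve-∀
          cancel : ∀ (r tq : ℤ) → (r + tq) - r ≡ tq
          cancel = solve-∀
      a≡b+r : a ≡ b + + r [mod q ]
      a≡b+r = Signed.∣⇒∣ᵤ (Signed.divides t (remove-remainder a b (+ r) (t * + q) (a≡a%ℕn+[a/ℕn]*n (a - b) q)))

module Fibonacci where

  open import Data.Nat as ℕ using (ℕ; zero; suc; _≤_; _<_; z≤n; s≤s)
  import Data.Nat.Properties as ℕₚ
  import Data.Nat.Tactic.RingSolver as ℕSolver
  open import Data.Integer using (ℤ; +_; ∣_∣; _+_; _-_; -_; _*_)
  import Data.Integer.Properties as ℤₚ
  open import Data.Integer.Tactic.RingSolver using (solve-∀)
  open import Data.Product using (Σ; _×_; _,_)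
  open import Relation.Nullary using (yes; no)
  open import Data.Empty using (⊥-elim)
  open import Relation.Binary.PropositionalEquality
    using (_≡_; refl; sym; trans; cong; cong₂; module ≡-Reasoning)

  -- The classical Fibonacci numbers F 0 = 0, F 1 = 1, F 2 = 1, ..., so that
  -- fib n = F (n + 1); F n is the predecessor of fib n, also at n = 0.
  -- Comments below use the classical indexing F(·).
  F : ℕ → ℕ
  F zero = 0
  F (suc n) = fib n

  sign : ℕ → ℤ
  sign zero = + 1
  sign (suc n) = - sign n

  sign² : ∀ n → sign n * sign n ≡ + 1
  sign² zero = refl
  sign² (suc n) = trans (square-neg (sign n)) (sign² n)
    where
      square-neg : ∀ (x : ℤ) → - x * - x ≡ x * x
      square-neg = solve-∀

  ∣sign*∣ : ∀ n x → ∣ sign n * x ∣ ≡ ∣ x ∣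
  ∣sign*∣ zero x = cong ∣_∣ (ℤₚ.*-identityˡ x)
  ∣sign*∣ (suc n) x =
    trans (cong ∣_∣ (sym (ℤₚ.neg-distribˡ-* (sign n) x)))
          (trans (ℤₚ.∣-i∣≡∣i∣ (sign n * x)) (∣sign*∣ n x))

  fib-pos : ∀ n → 1 ≤ fib n
  fib-pos zero = s≤s z≤n
  fib-pos (suc zero) = s≤s z≤n
  fib-pos (suc (suc n)) = ℕₚ.≤-trans (fib-pos (suc n)) (ℕₚ.m≤m+n _ _)

  fib-nonZero : ∀ n → ℕ.NonZero (fib n)
  fib-nonZero n = ℕ.>-nonZero (fib-pos n)

  fib-suc : ∀ n → fib (suc n) ≡ fib n ℕ.+ F n
  fib-suc zero = refl
  fib-suc (suc n) = refl

  fib-step : ∀ n → fib n ≤ fib (suc n)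
  fib-step n = ℕₚ.≤-trans (ℕₚ.m≤m+n (fib n) (F n)) (ℕₚ.≤-reflexive (sym (fib-suc n)))

  fib-suc≤2*fib : ∀ n → fib (suc n) ≤ 2 ℕ.* fib n
  fib-suc≤2*fib zero = s≤s z≤n
  fib-suc≤2*fib (suc n) = ℕₚ.+-monoʳ-≤ (fib (suc n)) (ℕₚ.≤-trans (fib-step n) (ℕₚ.m≤m+n _ 0))

  fib-add : ∀ n m → fib (n ℕ.+ suc m) ≡ fib (suc m) ℕ.* fib n ℕ.+ fib m ℕ.* F n
  fib-add zero m = base (fib (suc m)) (fib m)
    where
      base : ∀ a b → a ≡ a ℕ.* 1 ℕ.+ b ℕ.* 0
      base = ℕSolver.solve-∀
  fib-add (suc n) m = begin
    fib (suc n ℕ.+ suc m)                                     ≡⟨ cong fib (sym (ℕₚ.+-suc n (suc m))) ⟩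
    fib (n ℕ.+ suc (suc m))                                   ≡⟨ fib-add n (suc m) ⟩
    (fib (suc m) ℕ.+ fib m) ℕ.* fib n ℕ.+ fib (suc m) ℕ.* F n ≡⟨ regroup (fib (suc m)) (fib m) (fib n) (F n) ⟩
    fib (suc m) ℕ.* (fib n ℕ.+ F n) ℕ.+ fib m ℕ.* fib n       ≡⟨ cong (λ x → fib (suc m) ℕ.* x ℕ.+ fib m ℕ.* fib n) (sym (fib-suc n)) ⟩
    fib (suc m) ℕ.* fib (suc n) ℕ.+ fib m ℕ.* F (suc n)       ∎
    where
      open ≡-Reasoning
      regroup : ∀ a b c d → (a ℕ.+ b) ℕ.* c ℕ.+ a ℕ.* d ≡ a ℕ.* (c ℕ.+ d) ℕ.+ b ℕ.* c
      regroup = ℕSolver.solve-∀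

  d'Ocagne : ∀ n k → + fib (n ℕ.+ k) * + fib n - + fib (suc (n ℕ.+ k)) * + F n ≡ sign n * + fib k
  d'Ocagne zero k = base (+ fib k) (+ fib (suc k))
    where
      base : ∀ (a b : ℤ) → a * + 1 - b * + 0 ≡ + 1 * a
      base = solve-∀
  d'Ocagne (suc n) k = begin
    a * + fib (suc n) - + fib (suc (suc (n ℕ.+ k))) * c ≡⟨ cong₂ (λ x y → a * x - y * c) fib-c fib-a ⟩
    a * (c + d) - (a + b) * c                            ≡⟨ reflect a b c d ⟩
    - (b * c - a * d)                                    ≡⟨ cong -_ (d'Ocagne n k) ⟩
    - (sign n * + fib k)                                 ≡⟨ ℤₚ.neg-distribˡ-* (sign n) (+ fib k) ⟩
    sign (suc n) * + fib k                               ∎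
    where
      open ≡-Reasoning
      a = + fib (suc (n ℕ.+ k))
      b = + fib (n ℕ.+ k)
      c = + fib n
      d = + F n
      fib-c : + fib (suc n) ≡ c + d
      fib-c = trans (cong +_ (fib-suc n)) (ℤₚ.pos-+ (fib n) (F n))
      fib-a : + fib (suc (suc (n ℕ.+ k))) ≡ a + b
      fib-a = ℤₚ.pos-+ (fib (suc (n ℕ.+ k))) (fib (n ℕ.+ k))
      reflect : ∀ (a b c d : ℤ) → a * (c + d) - (a + b) * c ≡ - (b * c - a * d)
      reflect = solve-∀

  cassini : ∀ n → + fib n * + fib n - + fib (suc n) * + F n ≡ sign n
  cassini n = trans (cong (λ m → + fib m * + fib n - + fib (suc m) * + F n) (sym (ℕₚ.+-identityʳ n)))
                    (trans (d'Ocagne n 0) (ℤₚ.*-identityʳ (sign n)))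

  fib-bracket : ∀ L M → 1 ≤ M → M < fib L →
                Σ ℕ λ n → Σ ℕ λ m → n ℕ.+ suc m ≡ L × fib n ≤ M × M < fib (suc n)
  fib-bracket zero M 1≤M M<1 = ⊥-elim (ℕₚ.<⇒≱ M<1 1≤M)
  fib-bracket (suc L) M 1≤M M<fib[L+1] with M ℕ.<? fib L
  ... | yes M<fib[L] with fib-bracket L M 1≤M M<fib[L]
  ...   | n , m , refl , lo , hi = n , suc m , ℕₚ.+-suc n (suc m) , lo , hi
  fib-bracket (suc L) M 1≤M M<fib[L+1] | no M≮fib[L] =
    L , 0 , ℕₚ.+-comm L 1 , ℕₚ.≮⇒≥ M≮fib[L] , M<fib[L+1]

module Casts where

  import Data.Nat as ℕ
  open import Data.Integer using (+_; ∣_∣; _+_; _*_)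
  import Data.Integer.Properties as ℤₚ
  open import Relation.Binary.PropositionalEquality using (_≡_; sym; trans; cong; cong₂)

  pos-combination : ∀ a x b y → + (a ℕ.* x ℕ.+ b ℕ.* y) ≡ + a * + x + + b * + y
  pos-combination a x b y = trans (ℤₚ.pos-+ (a ℕ.* x) (b ℕ.* y)) (cong₂ _+_ (ℤₚ.pos-* a x) (ℤₚ.pos-* b y))

  ∣pos-combination∣ : ∀ a x b y → ∣ + a * + x + + b * + y ∣ ≡ a ℕ.* x ℕ.+ b ℕ.* y
  ∣pos-combination∣ a x b y = cong ∣_∣ (sym (pos-combination a x b y))

module Separation where

  open LeeMetric
  open Fibonacci
  open Casts

  open import Data.Nat as ℕ using (ℕ; zero; suc; _≤_; _<_; _⊔_; z≤n; s≤s)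
  import Data.Nat.Properties as ℕₚ
  open import Data.Integer using (ℤ; +_; -[1+_]; ∣_∣; _+_; _-_; -_; _*_)
  import Data.Integer.Properties as ℤₚ
  open import Data.Integer.Tactic.RingSolver using (solve-∀)
  import Data.Nat.Tactic.RingSolver as ℕSolver
  open import Data.Product using (_,_)
  open import Data.Empty using (⊥-elim)
  open import Relation.Binary.PropositionalEquality
    using (_≡_; _≢_; refl; sym; trans; cong; cong₂; subst; module ≡-Reasoning)

  -- X = 0 is impossible since then
  -- |aX - bY| = b|Y| is either 0 or at least b; so is X > 0 with Y < 0, since
  -- then aX - bY ≥ b; and X > 0 with Y ≥ 0 gives cX + dY ≥ c.
  same-sign-bound⁺ : ∀ a b c d x (Y : ℤ) → 0 < ∣ + a * + x - + b * Y ∣ → ∣ + a * + x - + b * Y ∣ < b →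
                     c ≤ ∣ + c * + x + + d * Y ∣
  same-sign-bound⁺ a b c d zero Y nonzero small = ⊥-elim (ℕₚ.<⇒≱ small b≤)
    where
      ∣-bY∣ : ∣ + a * + 0 - + b * Y ∣ ≡ b ℕ.* ∣ Y ∣
      ∣-bY∣ = trans (cong ∣_∣ (drop-a (+ a) (+ b) Y)) (trans (ℤₚ.∣-i∣≡∣i∣ (+ b * Y)) (ℤₚ.abs-* (+ b) Y))
        where
          drop-a : ∀ (a b Y : ℤ) → a * + 0 - b * Y ≡ - (b * Y)
          drop-a = solve-∀
      b≤ : b ≤ ∣ + a * + 0 - + b * Y ∣
      b≤ with ∣ Y ∣ | ∣-bY∣
      ... | zero  | eq = ⊥-elim (ℕₚ.<-irrefl (sym (trans eq (ℕₚ.*-zeroʳ b))) nonzero)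
      ... | suc y | eq = subst (b ≤_) (sym eq) (ℕₚ.m≤m*n b (suc y))
  same-sign-bound⁺ a b c d (suc x) (+ y) nonzero small =
    subst (c ≤_) (sym (∣pos-combination∣ c (suc x) d y)) (ℕₚ.≤-trans (ℕₚ.m≤m*n c (suc x)) (ℕₚ.m≤m+n _ _))
  same-sign-bound⁺ a b c d (suc x) -[1+ y ] nonzero small = ⊥-elim (ℕₚ.<⇒≱ small b≤)
    where
      both-positive : ∀ (a b X Y : ℤ) → a * X - b * (- Y) ≡ a * X + b * Y
      both-positive = solve-∀
      b≤ : b ≤ ∣ + a * + suc x - + b * -[1+ y ] ∣
      b≤ = subst (b ≤_) (sym (trans (cong ∣_∣ (both-positive (+ a) (+ b) (+ suc x) (+ suc y)))
                                    (∣pos-combination∣ a (suc x) b (suc y))))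
                 (ℕₚ.≤-trans (ℕₚ.m≤m*n b (suc y)) (ℕₚ.m≤n+m _ _))

  -- If 0 < |aX - bY| < b (with a, b ≥ 0), then X ≠ 0 and Y is zero or of the
  -- same sign as X; hence |cX + dY| ≥ c for all c, d ≥ 0.  Negative X reduces
  -- to the case X ≥ 0 by replacing (X, Y) with (-X, -Y).
  same-sign-bound : ∀ a b c d (X Y : ℤ) → 0 < ∣ + a * X - + b * Y ∣ → ∣ + a * X - + b * Y ∣ < b →
                    c ≤ ∣ + c * X + + d * Y ∣
  same-sign-bound a b c d (+ x) Y = same-sign-bound⁺ a b c d x Y
  same-sign-bound a b c d -[1+ x ] Y nonzero small =
    subst (c ≤_) (negate-sum (+ c) (+ d))
          (same-sign-bound⁺ a b c d (suc x) (- Y) (subst (0 <_) (sym (negate-difference (+ a) (+ b))) nonzero)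
                                                   (subst (_< b) (sym (negate-difference (+ a) (+ b))) small))
    where
      ∣negate∣ : ∀ (e f : ℤ) → e ≡ - f → ∣ e ∣ ≡ ∣ f ∣
      ∣negate∣ e f e≡-f = trans (cong ∣_∣ e≡-f) (ℤₚ.∣-i∣≡∣i∣ f)
      negate-difference : ∀ (a b : ℤ) → ∣ a * + suc x - b * - Y ∣ ≡ ∣ a * -[1+ x ] - b * Y ∣
      negate-difference a b = ∣negate∣ _ _ (ring a b (+ suc x) Y)
        where
          ring : ∀ (a b X Y : ℤ) → a * X - b * - Y ≡ - (a * - X - b * Y)
          ring = solve-∀
      negate-sum : ∀ (c d : ℤ) → ∣ c * + suc x + d * - Y ∣ ≡ ∣ c * -[1+ x ] + d * Y ∣
      negate-sum c d = ∣negate∣ _ _ (ring c d (+ suc x) Y)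
        where
          ring : ∀ (c d X Y : ℤ) → c * X + d * - Y ≡ - (c * - X + d * Y)
          ring = solve-∀

  -- In the coordinates X = F(n+1)w - F(n+2)k, Y = F(n)w - F(n+1)k
  -- Cassini's identity gives F(n+1)X - F(n+2)Y = ±w, and the addition formula
  -- gives p w - q k = F(m+2)X + F(m+1)Y, so same-sign-bound applies.
  fib-lattice-gap : ∀ n m (w k : ℤ) → fib n ≤ ∣ w ∣ → ∣ w ∣ < fib (suc n) →
                    fib (suc m) ≤ ∣ + fib (n ℕ.+ suc m) * w - + fib (suc n ℕ.+ suc m) * k ∣
  fib-lattice-gap n m w k lo hi =
    subst (fib (suc m) ≤_) (cong ∣_∣ combination)
      (same-sign-bound (fib n) (fib (suc n)) (fib (suc m)) (fib m) X Y
        (subst (0 <_) (sym ∣w∣) (ℕₚ.≤-trans (fib-pos n) lo))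
        (subst (_< fib (suc n)) (sym ∣w∣) hi))
    where
      X = + fib n * w - + fib (suc n) * k
      Y = + F n * w - + fib n * k
      ∣w∣ : ∣ + fib n * X - + fib (suc n) * Y ∣ ≡ ∣ w ∣
      ∣w∣ = begin
        ∣ + fib n * X - + fib (suc n) * Y ∣                              ≡⟨ cong ∣_∣ (eliminate-k (+ fib n) (+ fib (suc n)) (+ F n) w k) ⟩
        ∣ (+ fib n * + fib n - + fib (suc n) * + F n) * w ∣              ≡⟨ cong (λ s → ∣ s * w ∣) (cassini n) ⟩
        ∣ sign n * w ∣                                                   ≡⟨ ∣sign*∣ n w ⟩
        ∣ w ∣                                                            ∎
        where
          open ≡-Reasoning
          eliminate-k : ∀ (a b c w k : ℤ) → a * (a * w - b * k) - b * (c * w - a * k) ≡ (a * a - b * c) * w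
          eliminate-k = solve-∀
      combination : + fib (suc m) * X + + fib m * Y ≡ + fib (n ℕ.+ suc m) * w - + fib (suc n ℕ.+ suc m) * k
      combination = begin
        + fib (suc m) * X + + fib m * Y
          ≡⟨ regroup (+ fib (suc m)) (+ fib m) (+ fib n) (+ fib (suc n)) (+ F n) w k ⟩
        (+ fib (suc m) * + fib n + + fib m * + F n) * w - (+ fib (suc m) * + fib (suc n) + + fib m * + fib n) * k
          ≡⟨ cong₂ (λ p q → p * w - q * k) (sym p≡) (sym q≡) ⟩
        + fib (n ℕ.+ suc m) * w - + fib (suc n ℕ.+ suc m) * k ∎
        where
          open ≡-Reasoning
          regroup : ∀ (a b c d e w k : ℤ) → a * (c * w - d * k) + b * (e * w - c * k) ≡ (a * c + b * e) * w - (a * d + b * c) * k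
          regroup = solve-∀
          p≡ : + fib (n ℕ.+ suc m) ≡ + fib (suc m) * + fib n + + fib m * + F n
          p≡ = trans (cong +_ (fib-add n m)) (pos-combination (fib (suc m)) (fib n) (fib m) (F n))
          q≡ : + fib (suc n ℕ.+ suc m) ≡ + fib (suc m) * + fib (suc n) + + fib m * + fib n
          q≡ = trans (cong +_ (fib-add (suc n) m)) (pos-combination (fib (suc m)) (fib (suc n)) (fib m) (fib n))

  fib-split-bound : ∀ n m → fib (suc n ℕ.+ suc m) ≤ 3 ℕ.* (fib (suc m) ℕ.* fib n)
  fib-split-bound n m = begin
    fib (suc n ℕ.+ suc m)                                   ≡⟨ fib-add (suc n) m ⟩
    fib (suc m) ℕ.* fib (suc n) ℕ.+ fib m ℕ.* fib n          ≤⟨ ℕₚ.+-mono-≤ (ℕₚ.*-monoʳ-≤ (fib (suc m)) (fib-suc≤2*fib n))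
                                                                           (ℕₚ.*-monoˡ-≤ (fib n) (fib-step m)) ⟩
    fib (suc m) ℕ.* (2 ℕ.* fib n) ℕ.+ fib (suc m) ℕ.* fib n  ≡⟨ collect (fib (suc m)) (fib n) ⟩
    3 ℕ.* (fib (suc m) ℕ.* fib n)                            ∎
    where
      open ℕₚ.≤-Reasoning
      collect : ∀ a b → a ℕ.* (2 ℕ.* b) ℕ.+ a ℕ.* b ≡ 3 ℕ.* (a ℕ.* b)
      collect = ℕSolver.solve-∀

  -- A shortest offset j between pv′ and pv has the
  -- form p(v - v′) - q t, so the lattice gap bounds it below by fib (m+1).
  separation-core : ∀ n m (v v′ : ℤ) {d} → fib n ≤ ∣ v - v′ ∣ → ∣ v - v′ ∣ < fib (suc n) →
                    IsLee (fib (suc n ℕ.+ suc m)) (+ fib (n ℕ.+ suc m) * v) (+ fib (n ℕ.+ suc m) * v′) d →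
                    fib (suc n ℕ.+ suc m) ≤ 3 ℕ.* (d ℕ.* ∣ v - v′ ∣)
  separation-core n m v v′ {d} lo hi ((j , pv≡pv′+j , ∣j∣≡d) , _)
    with congruence-quotient (+ fib (n ℕ.+ suc m) * v) (+ fib (n ℕ.+ suc m) * v′) pv≡pv′+j
  ... | t , pv-[pv′+j]≡tq = begin
    fib (suc n ℕ.+ suc m)               ≤⟨ fib-split-bound n m ⟩
    3 ℕ.* (fib (suc m) ℕ.* fib n)        ≤⟨ ℕₚ.*-monoʳ-≤ 3 (ℕₚ.*-mono-≤ fib[m+1]≤d lo) ⟩
    3 ℕ.* (d ℕ.* ∣ v - v′ ∣)             ∎
    where
      open ℕₚ.≤-Reasoning
      solve-offset : ∀ (p q v v′ j t : ℤ) → p * v - (p * v′ + j) ≡ t * q → j ≡ p * (v - v′) - q * t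
      solve-offset p q v v′ j t eq = trans (isolate p v v′ j) (trans (cong (λ x → p * v - p * v′ - x) eq) (factor p q v v′ t))
        where
          isolate : ∀ (p v v′ j : ℤ) → j ≡ p * v - p * v′ - (p * v - (p * v′ + j))
          isolate = solve-∀
          factor : ∀ (p q v v′ t : ℤ) → p * v - p * v′ - t * q ≡ p * (v - v′) - q * t
          factor = solve-∀
      j≡ = solve-offset (+ fib (n ℕ.+ suc m)) (+ fib (suc n ℕ.+ suc m)) v v′ j t pv-[pv′+j]≡tq
      fib[m+1]≤d : fib (suc m) ≤ d
      fib[m+1]≤d = subst (fib (suc m) ≤_) (trans (cong ∣_∣ (sym j≡)) ∣j∣≡d) (fib-lattice-gap n m (v - v′) t lo hi)

  distinct⇒1≤∣i-j∣ : ∀ (v v′ : ℤ) → v ≢ v′ → 1 ≤ ∣ v - v′ ∣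
  distinct⇒1≤∣i-j∣ v v′ v≢v′ with ∣ v - v′ ∣ in eq
  ... | zero  = ⊥-elim (v≢v′ (ℤₚ.i-j≡0⇒i≡j v v′ (ℤₚ.∣i∣≡0⇒i≡0 eq)))
  ... | suc _ = s≤s z≤n

  -- Points of size below q/4 differ by less than p, because q ≤ 2p.
  difference-below-p : ∀ L (v v′ : ℤ) → ∣ v ∣ ℕ.* 4 < fib (suc L) → ∣ v′ ∣ ℕ.* 4 < fib (suc L) →
                       ∣ v - v′ ∣ < fib L
  difference-below-p L v v′ small small′ = ℕₚ.*-cancelʳ-< 4 ∣ v - v′ ∣ (fib L) (begin-strict
    ∣ v - v′ ∣ ℕ.* 4                  ≤⟨ ℕₚ.*-monoˡ-≤ 4 (ℤₚ.∣i-j∣≤∣i∣+∣j∣ v v′) ⟩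
    (∣ v ∣ ℕ.+ ∣ v′ ∣) ℕ.* 4          ≡⟨ ℕₚ.*-distribʳ-+ 4 ∣ v ∣ ∣ v′ ∣ ⟩
    ∣ v ∣ ℕ.* 4 ℕ.+ ∣ v′ ∣ ℕ.* 4      <⟨ ℕₚ.+-mono-< small small′ ⟩
    fib (suc L) ℕ.+ fib (suc L)       ≤⟨ ℕₚ.+-mono-≤ (fib-suc≤2*fib L) (fib-suc≤2*fib L) ⟩
    2 ℕ.* fib L ℕ.+ 2 ℕ.* fib L       ≡⟨ collect (fib L) ⟩
    fib L ℕ.* 4                       ∎)
    where
      open ℕₚ.≤-Reasoning
      collect : ∀ p → 2 ℕ.* p ℕ.+ 2 ℕ.* p ≡ p ℕ.* 4
      collect = ℕSolver.solve-∀

  -- Separation.  If v ≠ v′ and 4|v|, 4|v′| < q, then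
  -- q < 7 ρ_q(pv, pv′) max(|v|, |v′|): the difference 1 ≤ |v - v′| < p lies in
  -- a Fibonacci bracket below L, and |v - v′| ≤ 2 max(|v|, |v′|).
  separation : ∀ L (v v′ : ℤ) → v ≢ v′ → ∣ v ∣ ℕ.* 4 < fib (suc L) → ∣ v′ ∣ ℕ.* 4 < fib (suc L) →
               ∀ {d} → IsLee (fib (suc L)) (+ fib L * v) (+ fib L * v′) d →
               fib (suc L) < 7 ℕ.* (d ℕ.* (∣ v ∣ ⊔ ∣ v′ ∣))
  separation L v v′ v≢v′ small small′ {d} lee
    with fib-bracket L ∣ v - v′ ∣ (distinct⇒1≤∣i-j∣ v v′ v≢v′) (difference-below-p L v v′ small small′)
  ... | n , m , refl , lo , hi = six⇒seven {y = d ℕ.* M} (fib-pos (suc L)) (begin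
    fib (suc L)                            ≤⟨ separation-core n m v v′ lo hi lee ⟩
    3 ℕ.* (d ℕ.* ∣ v - v′ ∣)               ≤⟨ ℕₚ.*-monoʳ-≤ 3 (ℕₚ.*-monoʳ-≤ d ∣v-v′∣≤M+M) ⟩
    3 ℕ.* (d ℕ.* (M ℕ.+ M))                ≡⟨ collect d M ⟩
    6 ℕ.* (d ℕ.* M)                        ∎)
    where
      open ℕₚ.≤-Reasoning
      M = ∣ v ∣ ⊔ ∣ v′ ∣
      ∣v-v′∣≤M+M : ∣ v - v′ ∣ ≤ M ℕ.+ M
      ∣v-v′∣≤M+M = ℕₚ.≤-trans (ℤₚ.∣i-j∣≤∣i∣+∣j∣ v v′) (ℕₚ.+-mono-≤ (ℕₚ.m≤m⊔n ∣ v ∣ ∣ v′ ∣) (ℕₚ.m≤n⊔m ∣ v ∣ ∣ v′ ∣))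
      collect : ∀ d M → 3 ℕ.* (d ℕ.* (M ℕ.+ M)) ≡ 6 ℕ.* (d ℕ.* M)
      collect = ℕSolver.solve-∀
      six⇒seven : ∀ {x y} → 0 < x → x ≤ 6 ℕ.* y → x < 7 ℕ.* y
      six⇒seven {y = zero}  0<x x≤0 = ⊥-elim (ℕₚ.<⇒≱ 0<x (ℕₚ.≤-trans x≤0 (ℕₚ.≤-reflexive (ℕₚ.*-zeroʳ 6))))
      six⇒seven {y = suc y} 0<x x≤6y = ℕₚ.≤-<-trans x≤6y (ℕₚ.*-monoˡ-< (suc y) (ℕₚ.n<1+n 6))

module Approximation where

  open LeeMetric
  open Fibonacci
  open Casts

  open import Data.Nat as ℕ using (ℕ; zero; suc; _≤_; _<_; _⊔_; _∸_; z≤n; NonZero)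
  import Data.Nat.Properties as ℕₚ
  open import Data.Nat.DivMod using (_/_; _%_; m≡m%n+[m/n]*n; m%n<n)
  open import Data.Integer as ℤ using (ℤ; +_; ∣_∣; _+_; _-_; -_; _*_)
  import Data.Integer.Properties as ℤₚ
  import Data.Integer.Divisibility.Signed as Signed
  open import Data.Integer.Tactic.RingSolver using (solve-∀)
  import Data.Nat.Tactic.RingSolver as ℕSolver
  open import Data.Product using (Σ; _×_; _,_; proj₁; proj₂)
  open import Relation.Binary.PropositionalEquality
    using (_≡_; refl; sym; trans; cong; cong₂; subst; module ≡-Reasoning)

  -- Let q = γα + δβ > 0, and divide with remainder: iα = r₂ + yq, iβ = r₁ + xq.
  -- Then xδ + yγ approximates i from below with error e < γ + δ, because
  -- iq = (xδ + yγ)q + (r₁δ + r₂γ) and r₁δ + r₂γ < (γ + δ)q.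
  floor-combination : ∀ i q α β γ δ .{{_ : NonZero q}} .{{_ : NonZero γ}} → q ≡ γ ℕ.* α ℕ.+ δ ℕ.* β →
                      Σ ℕ λ e → i ≡ (i ℕ.* β / q) ℕ.* δ ℕ.+ (i ℕ.* α / q) ℕ.* γ ℕ.+ e × e < γ ℕ.+ δ
  floor-combination i q α β γ δ q≡ = i ∸ Y , sym (ℕₚ.m+[n∸m]≡n Y≤i) , e<γ+δ
    where
      x = i ℕ.* β / q
      y = i ℕ.* α / q
      r₁ = i ℕ.* β % q
      r₂ = i ℕ.* α % q
      Y = x ℕ.* δ ℕ.+ y ℕ.* γ
      R = r₁ ℕ.* δ ℕ.+ r₂ ℕ.* γ
      Yq+R≡iq : Y ℕ.* q ℕ.+ R ≡ i ℕ.* q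
      Yq+R≡iq = begin
        Y ℕ.* q ℕ.+ R                                     ≡⟨ regroup x y γ δ r₁ r₂ q ⟩
        δ ℕ.* (r₁ ℕ.+ x ℕ.* q) ℕ.+ γ ℕ.* (r₂ ℕ.+ y ℕ.* q) ≡⟨ cong₂ (λ a b → δ ℕ.* a ℕ.+ γ ℕ.* b)
                                                                   (sym (m≡m%n+[m/n]*n (i ℕ.* β) q))
                                                                   (sym (m≡m%n+[m/n]*n (i ℕ.* α) q)) ⟩
        δ ℕ.* (i ℕ.* β) ℕ.+ γ ℕ.* (i ℕ.* α)               ≡⟨ factor i α β γ δ ⟩
        i ℕ.* (γ ℕ.* α ℕ.+ δ ℕ.* β)                       ≡⟨ cong (i ℕ.*_) (sym q≡) ⟩
        i ℕ.* q                                           ∎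
        where
          open ≡-Reasoning
          regroup : ∀ x y γ δ r₁ r₂ q → (x ℕ.* δ ℕ.+ y ℕ.* γ) ℕ.* q ℕ.+ (r₁ ℕ.* δ ℕ.+ r₂ ℕ.* γ)
                                       ≡ δ ℕ.* (r₁ ℕ.+ x ℕ.* q) ℕ.+ γ ℕ.* (r₂ ℕ.+ y ℕ.* q)
          regroup = ℕSolver.solve-∀
          factor : ∀ i α β γ δ → δ ℕ.* (i ℕ.* β) ℕ.+ γ ℕ.* (i ℕ.* α) ≡ i ℕ.* (γ ℕ.* α ℕ.+ δ ℕ.* β)
          factor = ℕSolver.solve-∀
      Y≤i : Y ≤ i
      Y≤i = ℕₚ.*-cancelʳ-≤ Y i q (subst (Y ℕ.* q ≤_) Yq+R≡iq (ℕₚ.m≤m+n (Y ℕ.* q) R))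
      [i∸Y]q≡R : (i ∸ Y) ℕ.* q ≡ R
      [i∸Y]q≡R = trans (ℕₚ.*-distribʳ-∸ q i Y) (trans (cong (ℕ._∸ Y ℕ.* q) (sym Yq+R≡iq)) (ℕₚ.m+n∸m≡n (Y ℕ.* q) R))
      R<[γ+δ]q : R < (γ ℕ.+ δ) ℕ.* q
      R<[γ+δ]q = subst (R <_) (collect q γ δ)
        (ℕₚ.+-mono-≤-< (ℕₚ.*-monoˡ-≤ δ (ℕₚ.<⇒≤ (m%n<n (i ℕ.* β) q))) (ℕₚ.*-monoˡ-< γ (m%n<n (i ℕ.* α) q)))
        where
          collect : ∀ q γ δ → q ℕ.* δ ℕ.+ q ℕ.* γ ≡ (γ ℕ.+ δ) ℕ.* q
          collect = ℕSolver.solve-∀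
      e<γ+δ : i ∸ Y < γ ℕ.+ δ
      e<γ+δ = ℕₚ.*-cancelʳ-< q (i ∸ Y) (γ ℕ.+ δ) (subst (_< (γ ℕ.+ δ) ℕ.* q) (sym [i∸Y]q≡R) R<[γ+δ]q)

  division-ℤ : ∀ m q .{{_ : NonZero q}} → + m ≡ + (m % q) + + (m / q) * + q
  division-ℤ m q = trans (cong +_ (m≡m%n+[m/n]*n m q))
                         (trans (ℤₚ.pos-+ (m % q) (m / q ℕ.* q)) (cong (λ z → + (m % q) + z) (ℤₚ.pos-* (m / q) q)))

  -- For the quotients x = ⌊iβ/q⌋, y = ⌊iα/q⌋ and remainders r₁ = iβ mod q,
  -- r₂ = iα mod q: q(yβ - xα) = r₁α - r₂β, since the terms iαβ cancel.
  floor-cross-identity : ∀ i q α β .{{_ : NonZero q}} →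
    + q * (+ (i ℕ.* α / q) * + β - + (i ℕ.* β / q) * + α) ≡ + (i ℕ.* β % q ℕ.* α) - + (i ℕ.* α % q ℕ.* β)
  floor-cross-identity i q α β = begin
    + q * (+ y * + β - + x * + α)
      ≡⟨ expand (+ q) (+ α) (+ β) (+ x) (+ y) (+ r₁) (+ r₂) ⟩
    (+ r₂ + + y * + q) * + β - (+ r₁ + + x * + q) * + α + (+ r₁ * + α - + r₂ * + β)
      ≡⟨ cong₂ (λ a b → a * + β - b * + α + (+ r₁ * + α - + r₂ * + β))
               (sym (division-ℤ (i ℕ.* α) q)) (sym (division-ℤ (i ℕ.* β) q)) ⟩
    + (i ℕ.* α) * + β - + (i ℕ.* β) * + α + (+ r₁ * + α - + r₂ * + β)
      ≡⟨ cong₂ (λ a b → a * + β - b * + α + (+ r₁ * + α - + r₂ * + β)) (ℤₚ.pos-* i α) (ℤₚ.pos-* i β) ⟩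
    + i * + α * + β - + i * + β * + α + (+ r₁ * + α - + r₂ * + β)
      ≡⟨ cancel (+ i) (+ α) (+ β) (+ r₁ * + α - + r₂ * + β) ⟩
    + r₁ * + α - + r₂ * + β
      ≡⟨ cong₂ _-_ (ℤₚ.pos-* r₁ α) (ℤₚ.pos-* r₂ β) ⟨
    + (r₁ ℕ.* α) - + (r₂ ℕ.* β) ∎
    where
      open ≡-Reasoning
      x = i ℕ.* β / q
      y = i ℕ.* α / q
      r₁ = i ℕ.* β % q
      r₂ = i ℕ.* α % q
      expand : ∀ (q α β x y r₁ r₂ : ℤ) →
               q * (y * β - x * α) ≡ (r₂ + y * q) * β - (r₁ + x * q) * α + (r₁ * α - r₂ * β)
      expand = solve-∀
      cancel : ∀ (i α β c : ℤ) → i * α * β - i * β * α + c ≡ c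
      cancel = solve-∀

  -- With β ≤ α, both r₁α and r₂β are below qα, so the cross term is small:
  -- |yβ - xα| < α.
  floor-cross-bound : ∀ i q α β .{{_ : NonZero q}} .{{_ : NonZero α}} → β ≤ α →
                      ∣ + (i ℕ.* α / q) * + β - + (i ℕ.* β / q) * + α ∣ < α
  floor-cross-bound i q α β β≤α = ℕₚ.*-cancelˡ-< q ∣ cross ∣ α (begin-strict
    q ℕ.* ∣ cross ∣                     ≡⟨ ℤₚ.abs-* (+ q) cross ⟨
    ∣ + q * cross ∣                     ≡⟨ cong ∣_∣ (floor-cross-identity i q α β) ⟩
    ∣ + (r₁ ℕ.* α) - + (r₂ ℕ.* β) ∣     ≡⟨ cong ∣_∣ (ℤₚ.m-n≡m⊖n (r₁ ℕ.* α) (r₂ ℕ.* β)) ⟩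
    ∣ r₁ ℕ.* α ℤ.⊖ r₂ ℕ.* β ∣           ≤⟨ ℤₚ.∣m⊝n∣≤m⊔n (r₁ ℕ.* α) (r₂ ℕ.* β) ⟩
    r₁ ℕ.* α ⊔ r₂ ℕ.* β                 <⟨ ℕₚ.⊔-lub r₁α<qα r₂β<qα ⟩
    q ℕ.* α                             ∎)
    where
      open ℕₚ.≤-Reasoning
      r₁ = i ℕ.* β % q
      r₂ = i ℕ.* α % q
      cross = + (i ℕ.* α / q) * + β - + (i ℕ.* β / q) * + α
      r₁α<qα : r₁ ℕ.* α < q ℕ.* α
      r₁α<qα = ℕₚ.*-monoˡ-< α (m%n<n (i ℕ.* β) q)
      r₂β<qα : r₂ ℕ.* β < q ℕ.* α
      r₂β<qα = ℕₚ.≤-<-trans (ℕₚ.*-monoʳ-≤ r₂ β≤α) (ℕₚ.*-monoˡ-< α (m%n<n (i ℕ.* α) q))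

  -- Modulo q = F(u+k+3), multiplication by p = F(u+k+2) sends
  -- (-1)ᵘ(y F(u+1) - x F(u+2)) to x F(k+1) + y F(k+2); this combines the
  -- d'Ocagne identities p F(u+1) - q F(u) = (-1)ᵘ F(k+2) and
  -- p F(u+2) - q F(u+1) = -(-1)ᵘ F(k+1).
  fib-multiplier : ∀ u k (x y : ℤ) →
    + fib (suc u ℕ.+ k) * (sign u * (y * + fib u - x * + fib (suc u)))
      ≡ (x * + fib k + y * + fib (suc k)) + + fib (suc (suc u ℕ.+ k)) * (sign u * (y * + F u - x * + fib u))
  fib-multiplier u k x y = begin
    p * (s * (y * fᵤ - x * fᵤ₊₁))
      ≡⟨ split p q s x y fᵤ fᵤ₊₁ Fᵤ ⟩
    s * y * (p * fᵤ - q * Fᵤ) - s * x * (p * fᵤ₊₁ - q * fᵤ) + w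
      ≡⟨ cong₂ (λ a b → s * y * a - s * x * b + w) d'Ocagne₁ (d'Ocagne (suc u) k) ⟩
    s * y * (s * fₖ₊₁) - s * x * (- s * fₖ) + w
      ≡⟨ collect s x y fₖ fₖ₊₁ w ⟩
    s * s * (x * fₖ + y * fₖ₊₁) + w
      ≡⟨ cong (λ z → z * (x * fₖ + y * fₖ₊₁) + w) (sign² u) ⟩
    + 1 * (x * fₖ + y * fₖ₊₁) + w
      ≡⟨ cong (_+ w) (ℤₚ.*-identityˡ (x * fₖ + y * fₖ₊₁)) ⟩
    x * fₖ + y * fₖ₊₁ + w ∎
    where
      open ≡-Reasoning
      p = + fib (suc u ℕ.+ k)
      q = + fib (suc (suc u ℕ.+ k))
      s = sign u
      fᵤ = + fib u
      fᵤ₊₁ = + fib (suc u)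
      Fᵤ = + F u
      fₖ = + fib k
      fₖ₊₁ = + fib (suc k)
      w = q * (s * (y * Fᵤ - x * fᵤ))
      d'Ocagne₁ : p * fᵤ - q * Fᵤ ≡ s * fₖ₊₁
      d'Ocagne₁ = trans (cong (λ n → + fib n * fᵤ - + fib (suc n) * Fᵤ) (sym (ℕₚ.+-suc u k)))
                        (d'Ocagne u (suc k))
      split : ∀ (p q s x y a b c : ℤ) →
              p * (s * (y * a - x * b)) ≡ s * y * (p * a - q * c) - s * x * (p * b - q * a) + q * (s * (y * c - x * a))
      split = solve-∀
      collect : ∀ (s x y a b w : ℤ) → s * y * (s * b) - s * x * (- s * a) + w ≡ s * s * (x * a + y * b) + w
      collect = solve-∀

  fib-modulus-split : ∀ u k → fib (suc (suc u ℕ.+ k)) ≡ fib (suc k) ℕ.* fib (suc u) ℕ.+ fib k ℕ.* fib u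
  fib-modulus-split u k = trans (cong fib (sym (ℕₚ.+-suc (suc u) k))) (fib-add (suc u) k)

  -- With α = F(u+2),
  -- β = F(u+1), γ = F(k+2), δ = F(k+1) we have q = γα + δβ.  The multiplier
  -- v = (-1)ᵘ(yβ - xα) built from the quotients of floor-combination has
  -- |v| < α, and pv ≡ xδ + yγ = i - e (mod q) with e < γ + δ ≤ 2γ, so
  -- ρ_q(i, pv) α ≤ eα ≤ 2γα ≤ 2q.
  approximation-suc : ∀ u k i → Σ ℤ λ v → ∣ v ∣ ≤ fib (suc u) × Σ ℕ λ d →
    IsLee (fib (suc (suc u ℕ.+ k))) (+ i) (+ fib (suc u ℕ.+ k) * v) d × d ℕ.* fib (suc u) ≤ 3 ℕ.* fib (suc (suc u ℕ.+ k))
  approximation-suc u k i = v , ∣v∣≤α , d , lee , bound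
    where
      p = fib (suc u ℕ.+ k)
      q = fib (suc (suc u ℕ.+ k))
      α = fib (suc u)
      β = fib u
      γ = fib (suc k)
      δ = fib k
      instance
        q≢0 : NonZero q
        q≢0 = fib-nonZero (suc (suc u ℕ.+ k))
        α≢0 : NonZero α
        α≢0 = fib-nonZero (suc u)
        γ≢0 : NonZero γ
        γ≢0 = fib-nonZero (suc k)
      decomposition = floor-combination i q α β γ δ (fib-modulus-split u k)
      e = proj₁ decomposition
      i≡xδ+yγ+e = proj₁ (proj₂ decomposition)
      e<γ+δ = proj₂ (proj₂ decomposition)
      x = i ℕ.* β / q
      y = i ℕ.* α / q
      v = sign u * (+ y * + β - + x * + α)
      ∣v∣≤α : ∣ v ∣ ≤ α
      ∣v∣≤α = subst (_≤ α) (sym (∣sign*∣ u _)) (ℕₚ.<⇒≤ (floor-cross-bound i q α β (fib-step u)))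
      d = proj₁ (lee-exists q (+ i) (+ p * v))
      lee = proj₂ (lee-exists q (+ i) (+ p * v))
      w = sign u * (+ y * + F u - + x * + β)
      i≡Y+e : + i ≡ (+ x * + δ + + y * + γ) + + e
      i≡Y+e = trans (cong +_ i≡xδ+yγ+e) (trans (ℤₚ.pos-+ _ e) (cong (λ z → z + + e) (pos-combination x δ y γ)))
      i≡pv+e : (+ i) ≡ + p * v + + e [mod q ]
      i≡pv+e = Signed.∣⇒∣ᵤ (Signed.divides (- w) (begin
        + i - (+ p * v + + e)                            ≡⟨ cong₂ (λ a b → a - (b + + e)) i≡Y+e (fib-multiplier u k (+ x) (+ y)) ⟩
        (Y + + e) - ((Y + + q * w) + + e)               ≡⟨ cancel Y (+ e) (+ q) w ⟩
        - w * + q ∎))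
        where
          open ≡-Reasoning
          Y = + x * + δ + + y * + γ
          cancel : ∀ (Y e q w : ℤ) → (Y + e) - ((Y + q * w) + e) ≡ - w * q
          cancel = solve-∀
      bound : d ℕ.* α ≤ 3 ℕ.* q
      bound = begin
        d ℕ.* α                 ≤⟨ ℕₚ.*-monoˡ-≤ α (proj₂ lee (+ e) i≡pv+e) ⟩
        e ℕ.* α                 ≤⟨ ℕₚ.*-monoˡ-≤ α (ℕₚ.<⇒≤ e<γ+δ) ⟩
        (γ ℕ.+ δ) ℕ.* α         ≤⟨ ℕₚ.*-monoˡ-≤ α (ℕₚ.+-monoʳ-≤ γ (fib-step k)) ⟩
        (γ ℕ.+ γ) ℕ.* α         ≡⟨ double γ α ⟩
        2 ℕ.* (γ ℕ.* α)         ≤⟨ ℕₚ.*-monoʳ-≤ 2 (ℕₚ.m≤m+n (γ ℕ.* α) (δ ℕ.* β)) ⟩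
        2 ℕ.* (γ ℕ.* α ℕ.+ δ ℕ.* β) ≡⟨ cong (2 ℕ.*_) (sym (fib-modulus-split u k)) ⟩
        2 ℕ.* q                 ≤⟨ ℕₚ.*-monoˡ-≤ q (ℕₚ.n≤1+n 2) ⟩
        3 ℕ.* q                 ∎
        where
          open ℕₚ.≤-Reasoning
          double : ∀ γ α → (γ ℕ.+ γ) ℕ.* α ≡ 2 ℕ.* (γ ℕ.* α)
          double = ℕSolver.solve-∀

  -- For t = 0 take v = 0, as ρ_q(i, 0) ≤ i ≤ q;
  -- otherwise t = u + 1 and L = t + k, which is approximation-suc.
  approximation : ∀ L i → i ≤ fib (suc L) → ∀ t → t ≤ L → Σ ℤ λ v → ∣ v ∣ ≤ fib t × Σ ℕ λ d →
    IsLee (fib (suc L)) (+ i) (+ fib L * v) d × d ℕ.* fib t ≤ 3 ℕ.* fib (suc L)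
  approximation L i i≤q zero _ = + 0 , z≤n , d , lee , bound
    where
      q = fib (suc L)
      instance
        q≢0 : NonZero q
        q≢0 = fib-nonZero (suc L)
      d = proj₁ (lee-exists q (+ i) (+ fib L * + 0))
      lee = proj₂ (lee-exists q (+ i) (+ fib L * + 0))
      i≡0+i : (+ i) ≡ + fib L * + 0 + + i [mod q ]
      i≡0+i = Signed.∣⇒∣ᵤ {k = + q} (Signed.divides (+ 0) (cancel (+ i) (+ fib L) (+ q)))
        where
          cancel : ∀ (i p q : ℤ) → i - (p * + 0 + i) ≡ + 0 * q
          cancel = solve-∀
      bound : d ℕ.* 1 ≤ 3 ℕ.* q
      bound = begin
        d ℕ.* 1    ≡⟨ ℕₚ.*-identityʳ d ⟩
        d          ≤⟨ proj₂ lee (+ i) i≡0+i ⟩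
        i          ≤⟨ i≤q ⟩
        q          ≤⟨ ℕₚ.m≤n*m q 3 ⟩
        3 ℕ.* q    ∎
        where open ℕₚ.≤-Reasoning
  approximation L i _ (suc u) t≤L with ℕₚ.m≤n⇒∃[o]m+o≡n t≤L
  ... | k , refl = approximation-suc u k i

module RationalBounds where

  open import Data.Nat as ℕ using (suc; z≤n; s≤s)
  import Data.Nat.Properties as ℕₚ
  open import Data.Integer as ℤ using (+_; -[1+_]; ∣_∣)
  import Data.Integer.Properties as ℤₚ
  open import Data.Rational as ℚ using (ℚ; 0ℚ; _<_; _*_; -_; _/_; toℚᵘ)
  import Data.Rational.Properties as ℚₚ
  open import Data.Rational.Unnormalised as ℚᵘ using (mkℚᵘ; *<*)
  import Data.Rational.Unnormalised.Properties as ℚᵘₚ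
  open import Relation.Binary.PropositionalEquality using (sym; trans; cong; subst₂)

  -- Comparisons of rationals are decided on unnormalised representatives,
  -- where x < y is a cross-multiplied inequality of integers.
  toℚᵘ-integer : ∀ i → toℚᵘ (i / 1) ℚᵘ.≃ mkℚᵘ i 0
  toℚᵘ-integer i = ℚₚ.toℚᵘ-fromℚᵘ (mkℚᵘ i 0)

  toℚᵘ-scale : ∀ (c : ℚ) q → toℚᵘ (c * (+ q / 1)) ℚᵘ.≃ toℚᵘ c ℚᵘ.* mkℚᵘ (+ q) 0
  toℚᵘ-scale c q = ℚᵘₚ.≃-trans (ℚₚ.toℚᵘ-homo-* c (+ q / 1)) (ℚᵘₚ.*-congˡ {toℚᵘ c} (toℚᵘ-integer (+ q)))

  below-quarter : ∀ v q → v / 1 < (+ 1 / 4) * (+ q / 1) → mkℚᵘ v 0 ℚᵘ.< mkℚᵘ (+ 1) 3 ℚᵘ.* mkℚᵘ (+ q) 0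
  below-quarter v q v<q/4 =
    ℚᵘₚ.<-respʳ-≃ (toℚᵘ-scale (+ 1 / 4) q) (ℚᵘₚ.<-respˡ-≃ (toℚᵘ-integer v) (ℚₚ.toℚᵘ-mono-< v<q/4))

  above-minus-quarter : ∀ v q → - ((+ 1 / 4) * (+ q / 1)) < v / 1 →
                        ℚᵘ.- (mkℚᵘ (+ 1) 3 ℚᵘ.* mkℚᵘ (+ q) 0) ℚᵘ.< mkℚᵘ v 0
  above-minus-quarter v q -q/4<v =
    ℚᵘₚ.<-respˡ-≃ (ℚᵘₚ.≃-trans (ℚₚ.toℚᵘ-homo‿- ((+ 1 / 4) * (+ q / 1))) (ℚᵘₚ.-‿cong (toℚᵘ-scale (+ 1 / 4) q)))
                  (ℚᵘₚ.<-respʳ-≃ (toℚᵘ-integer v) (ℚₚ.toℚᵘ-mono-< -q/4<v))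

  quarter-bound : ∀ v q → - ((+ 1 / 4) * (+ q / 1)) < v / 1 → v / 1 < (+ 1 / 4) * (+ q / 1) →
                  ∣ v ∣ ℕ.* 4 ℕ.< q
  quarter-bound (+ a) q _ v<q/4 with below-quarter (+ a) q v<q/4
  ... | *<* a*4<q =
    ℤₚ.drop‿+<+ (subst₂ ℤ._<_ (sym (ℤₚ.pos-* a 4)) (trans (ℤₚ.*-identityʳ _) (ℤₚ.*-identityˡ (+ q))) a*4<q)
  quarter-bound -[1+ a ] q -q/4<v _ with above-minus-quarter -[1+ a ] q -q/4<v
  ... | *<* -q<-[a+1]*4 =
    ℤₚ.drop‿+<+ (ℤₚ.neg-cancel-< (subst₂ ℤ._<_ (trans (ℤₚ.*-identityʳ _) (cong ℤ.-_ (ℤₚ.*-identityˡ (+ q))))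
                                               (trans (sym (ℤₚ.neg-distribˡ-* (+ suc a) (+ 4)))
                                                      (cong ℤ.-_ (sym (ℤₚ.pos-* (suc a) 4))))
                                               -q<-[a+1]*4))

  seventh-bound : ∀ q d M → q ℕ.< 7 ℕ.* (d ℕ.* M) → (+ 1 / 7) * (+ q / 1) < (+ d / 1) * (+ M / 1)
  seventh-bound q d M q<7dM =
    ℚₚ.toℚᵘ-cancel-< (ℚᵘₚ.<-respˡ-≃ (ℚᵘₚ.≃-sym (toℚᵘ-scale (+ 1 / 7) q)) (ℚᵘₚ.<-respʳ-≃ (ℚᵘₚ.≃-sym product) (*<* cross)))
    where
      product : toℚᵘ ((+ d / 1) * (+ M / 1)) ℚᵘ.≃ mkℚᵘ (+ d) 0 ℚᵘ.* mkℚᵘ (+ M) 0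
      product = ℚᵘₚ.≃-trans (ℚₚ.toℚᵘ-homo-* (+ d / 1) (+ M / 1)) (ℚᵘₚ.*-cong (toℚᵘ-integer (+ d)) (toℚᵘ-integer (+ M)))
      cross : (+ 1 ℤ.* + q) ℤ.* + 1 ℤ.< (+ d ℤ.* + M) ℤ.* + 7
      cross = subst₂ ℤ._<_ (sym (trans (ℤₚ.*-identityʳ _) (ℤₚ.*-identityˡ (+ q))))
                (trans (cong +_ (ℕₚ.*-comm 7 (d ℕ.* M))) (trans (ℤₚ.pos-* (d ℕ.* M) 7) (cong (ℤ._* + 7) (ℤₚ.pos-* d M))))
                (ℤ.+<+ q<7dM)

  0<1/7 : 0ℚ < + 1 / 7
  0<1/7 = ℚ.*<* (ℤ.+<+ (s≤s z≤n))

  0<1/4 : 0ℚ < + 1 / 4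
  0<1/4 = ℚ.*<* (ℤ.+<+ (s≤s z≤n))

open LeeMetric using (lee-exists)
open Fibonacci using (fib-nonZero)
open Separation using (separation)
open Approximation using (approximation)
open RationalBounds using (quarter-bound; seventh-bound; 0<1/7; 0<1/4)

open import Data.Nat using (ℕ; _≤_; _⊔_; suc) renaming (_*_ to _ℕ*_)
open import Data.Integer using (ℤ; +_; ∣_∣) renaming (_*_ to _ℤ*_)
open import Data.Rational using (ℚ; 0ℚ; _<_; _*_; -_; _/_)
open import Data.Product using (Σ; _×_; _,_; proj₁; proj₂)
open import Relation.Binary.PropositionalEquality using (_≢_)

lemma57 :
  Σ ℚ λ c₁ → Σ ℚ λ c₂ → (0ℚ < c₁) × (0ℚ < c₂) ×
    (∀ (L : ℕ) → 1 ≤ L →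
      (∀ (v v′ : ℤ) → v ≢ v′ →
        (- (c₂ * (+ fib (suc L) / 1)) < v / 1) → (v / 1 < c₂ * (+ fib (suc L) / 1)) →
        (- (c₂ * (+ fib (suc L) / 1)) < v′ / 1) → (v′ / 1 < c₂ * (+ fib (suc L) / 1)) →
        Σ ℕ λ d → IsLee (fib (suc L)) (+ fib L ℤ* v) (+ fib L ℤ* v′) d
          × (c₁ * (+ fib (suc L) / 1) < (+ d / 1) * (+ (∣ v ∣ ⊔ ∣ v′ ∣) / 1)))
      × (∀ (i : ℕ) → 1 ≤ i → i ≤ fib (suc L) → ∀ (t : ℕ) → t ≤ L →
        Σ ℤ λ v → (∣ v ∣ ≤ fib t) ×
          (Σ ℕ λ d → IsLee (fib (suc L)) (+ i) (+ fib L ℤ* v) d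
            × (d ℕ* fib t ≤ 3 ℕ* fib (suc L)))))
lemma57 = + 1 / 7 , + 1 / 4 , 0<1/7 , 0<1/4 , λ L _ → separated L , λ i _ → approximation L i
  where
    separated : ∀ L (v v′ : ℤ) → v ≢ v′ →
      (- ((+ 1 / 4) * (+ fib (suc L) / 1)) < v / 1) → (v / 1 < (+ 1 / 4) * (+ fib (suc L) / 1)) →
      (- ((+ 1 / 4) * (+ fib (suc L) / 1)) < v′ / 1) → (v′ / 1 < (+ 1 / 4) * (+ fib (suc L) / 1)) →
      Σ ℕ λ d → IsLee (fib (suc L)) (+ fib L ℤ* v) (+ fib L ℤ* v′) d
        × ((+ 1 / 7) * (+ fib (suc L) / 1) < (+ d / 1) * (+ (∣ v ∣ ⊔ ∣ v′ ∣) / 1))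
    separated L v v′ v≢v′ v>-q/4 v<q/4 v′>-q/4 v′<q/4 =
      proj₁ ρ , proj₂ ρ ,
      seventh-bound (fib (suc L)) (proj₁ ρ) (∣ v ∣ ⊔ ∣ v′ ∣)
        (separation L v v′ v≢v′ (quarter-bound v (fib (suc L)) v>-q/4 v<q/4)
                                (quarter-bound v′ (fib (suc L)) v′>-q/4 v′<q/4) (proj₂ ρ))
      where
        ρ = lee-exists (fib (suc L)) {{fib-nonZero (suc L)}} (+ fib L ℤ* v) (+ fib L ℤ* v′)
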